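{- Let $n, k, \ell$ be positive integers with $k\ell + 1 \leq n \leq k(\ell+1)-1$ and $\ell \geq 2$, and let $\mathcal{P}$ be an intersecting family of $(k,\ell)$-subpartitions of $[n]$. Assume that there is no $k$-set that occurs as a class in every $(k,\ell)$-subpartition in $\mathcal{P}$. Then $$|\mathcal{P}| \leq \ell(\ell-1)\, U(n-2k,\ell-2,k).$$
   Context: Let $[n]=\{1,\dots,n\}$. A $(k,\ell)$-subpartition of $[n]$ is a set $P=\{P_1,\dots,P_\ell\}$ of $\ell$ pairwise disjoint $k$-subsets of $[n]$ (called classes). Two $(k,\ell)$-subpartitions are intersecting if they have a common class; a family is intersecting if every two of its members are intersecting. For integers $m$, $j\ge 0$, $k$, define $U(m,j,k) = \frac{1}{j!}\prod_{i=0}^{j-1}\binom{m-ik}{k}$ (the number of $(k,j)$-subpartitions of an $m$-set; an empty product equals $1$, so $U(m,0,k)=1$). -}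

module Defs where

open import Data.Nat using (ℕ; zero; suc; _*_; _∸_; _/_; _!)
open import Data.Nat.Properties using (_!≢0)
open import Data.Nat.Combinatorics using (_C_)
open import Data.Fin.Subset using (Subset; ∣_∣; _∩_; ⊥)
open import Data.List using (List; length)
open import Data.List.Membership.Propositional using (_∈_)
open import Data.List.Relation.Unary.All using (All)
open import Data.List.Relation.Unary.AllPairs using (AllPairs)
open import Data.List.Relation.Unary.Unique.Propositional using (Unique)
open import Data.Product using (Σ; _×_)
open import Function.Bundles using (_⇔_)
open import Relation.Nullary using (¬_)
open import Relation.Binary.PropositionalEquality using (_≡_)

binomProd : ℕ → ℕ → ℕ → ℕ
binomProd m zero    k = 1
binomProd m (suc j) k = (m C k) * binomProd (m ∸ k) j k

-- U(m,j,k) = (1/j!) ∏_{i=0}^{j-1} C(m - ik, k)   (an integer: number of (k,j)-subpartitions of an m-set)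
U : ℕ → ℕ → ℕ → ℕ
U m j k = _/_ (binomProd m j k) (j !) {{j !≢0}}

-- A (k,ℓ)-subpartition of [n]: a duplicate-free list of ℓ pairwise disjoint k-subsets of Fin n
-- (the list is regarded as the set of its entries).
record IsSubpartition (n k ℓ : ℕ) (P : List (Subset n)) : Set where
  field
    unique   : Unique P
    size     : length P ≡ ℓ
    classes  : All (λ A → ∣ A ∣ ≡ k) P
    disjoint : AllPairs (λ A B → A ∩ B ≡ ⊥) P

SameSet : {n : ℕ} → List (Subset n) → List (Subset n) → Set
SameSet P Q = ∀ A → (A ∈ P) ⇔ (A ∈ Q)

-- A family of (k,ℓ)-subpartitions: a list of subpartitions, pairwise distinct as sets;
-- its cardinality is the length of the list.
record IsFamily (n k ℓ : ℕ) (F : List (List (Subset n))) : Set where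
  field
    members  : All (IsSubpartition n k ℓ) F
    distinct : AllPairs (λ P Q → ¬ SameSet P Q) F

Intersecting : {n : ℕ} → List (List (Subset n)) → Set
Intersecting F = ∀ P Q → P ∈ F → Q ∈ F → Σ _ (λ A → A ∈ P × A ∈ Q)

HasCommonClass : {n : ℕ} → ℕ → List (List (Subset n)) → Set
HasCommonClass {n} k F = Σ (Subset n) (λ A → ∣ A ∣ ≡ k × (∀ P → P ∈ F → A ∈ P))

-- Fix P₀ in the family.  As no class is common to all members, every class A of P₀ is
-- missed by some member Q_A, and since n < k(ℓ+1) at most ℓ − 1 classes of Q_A are
-- disjoint from A.  Each member R shares a class A with P₀ and a class B with Q_A; then
-- B ≠ A, so B ∩ A = ∅ and R contains one of at most ℓ(ℓ−1) such pairs (A, B).  Deleting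
-- A and B from the members containing both leaves distinct (k, ℓ−2)-subpartitions of the
-- (n−2k)-set [n] ∖ (A ∪ B), and there are at most U(n−2k, ℓ−2, k) of those: double
-- counting (class, subpartition) incidences gives (j+1)·#{(k,j+1)-subpartitions of an
-- m-set} ≤ C(m,k)·#{(k,j)-subpartitions of an (m−k)-set}.

module Submission where

open import Defs
open import Data.Bool using () renaming (_≟_ to _≟ᵇ_)
open import Data.Empty using (⊥-elim)
open import Data.Fin.Subset using (Subset; ∣_∣; _∩_; _∪_; _─_; ⋃; ⊤; ⊥; _⊆_; inside; outside)
import Data.Fin.Subset as Subset
open import Data.Fin.Subset.Properties
  using (drop-∷-⊆; ∉⊥; ∈⊤; x∈p∩q⁺; x∈p∧x∉q⇒x∈p─q; ∩-comm; ∩-zeroʳ; ∪-identityʳ; ∩-distribˡ-∪; ∣p∣≤n; ∣⊤∣≡n; ∣⊥∣≡0)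
open import Data.List using (List; []; _∷_; length; filter; map; _++_)
open import Data.List.Properties using (length-map; length-++; filter-notAll; filter-some; filter-all)
open import Data.List.Membership.Propositional using (_∈_; _∉_; find; lose)
open import Data.List.Membership.Propositional.Properties using (∈-filter⁺; ∈-filter⁻; ∈-map⁺; ∈-++⁺ˡ; ∈-++⁺ʳ)
open import Data.List.Relation.Unary.All as All using (All; []; _∷_)
import Data.List.Relation.Unary.All.Properties as All
open import Data.List.Relation.Unary.AllPairs using (AllPairs; []; _∷_)
import Data.List.Relation.Unary.AllPairs.Properties as AllPairs
open import Data.List.Relation.Unary.Any as Any using (Any; here; there)
import Data.List.Relation.Unary.Any.Properties as Any
open import Data.List.Relation.Unary.Unique.Propositional using (Unique)
import Data.List.Relation.Unary.Unique.Propositional.Properties as Unique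
open import Data.Nat using (ℕ; zero; suc; _+_; _*_; _∸_; _≤_; _<_; z≤n; s≤s; _!; NonZero)
open import Data.Nat.Combinatorics using (_C_; nCk+nC[k+1]≡[n+1]C[k+1])
open import Data.Nat.DivMod using (_/_; m*n/n≡m; /-monoˡ-≤)
open import Data.Nat.Properties
open import Algebra.Properties.CommutativeSemigroup +-commutativeSemigroup using (interchange)
open import Data.Product using (∃; _×_; _,_; proj₁; proj₂)
open import Data.Vec using (_∷_; [])
import Data.Vec as Vec
open import Data.Vec.Properties using (≡-dec; ∷-injectiveʳ)
open import Function using (_∘_; id)
open import Function.Bundles using (mk⇔; Equivalence)
open import Relation.Binary.Definitions using (DecidableEquality)
open import Relation.Binary.PropositionalEquality
  using (_≡_; _≢_; refl; sym; trans; cong; cong₂; subst; module ≡-Reasoning)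
open import Relation.Nullary using (¬_; Dec; yes; no; ¬?)
open import Relation.Nullary.Decidable using (_×-dec_)
open import Relation.Unary using (Decidable)

∑ : {X : Set} → List X → (X → ℕ) → ℕ
∑ []       f = 0
∑ (x ∷ xs) f = f x + ∑ xs f

module _ {X : Set} where

  ∑-cong : (xs : List X) {f g : X → ℕ} → (∀ x → f x ≡ g x) → ∑ xs f ≡ ∑ xs g
  ∑-cong []       f≡g = refl
  ∑-cong (x ∷ xs) f≡g = cong₂ _+_ (f≡g x) (∑-cong xs f≡g)

  ∑-+ : (xs : List X) (f g : X → ℕ) → ∑ xs (λ x → f x + g x) ≡ ∑ xs f + ∑ xs g
  ∑-+ []       f g = refl
  ∑-+ (x ∷ xs) f g = trans (cong (f x + g x +_) (∑-+ xs f g)) (interchange (f x) (g x) _ _)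

  *-∑ : (c : ℕ) (xs : List X) (f : X → ℕ) → c * ∑ xs f ≡ ∑ xs (λ x → c * f x)
  *-∑ c []       f = *-zeroʳ c
  *-∑ c (x ∷ xs) f = trans (*-distribˡ-+ c (f x) _) (cong (c * f x +_) (*-∑ c xs f))

  ∑-const : (xs : List X) (c : ℕ) → ∑ xs (λ _ → c) ≡ length xs * c
  ∑-const []       c = refl
  ∑-const (x ∷ xs) c = cong (c +_) (∑-const xs c)

  ∑-mono-≤ : (xs : List X) {f g : X → ℕ} → All (λ x → f x ≤ g x) xs → ∑ xs f ≤ ∑ xs g
  ∑-mono-≤ []       []         = z≤n
  ∑-mono-≤ (x ∷ xs) (fx≤gx ∷ h) = +-mono-≤ fx≤gx (∑-mono-≤ xs h)

count : {X : Set} {P : X → Set} → Decidable P → List X → ℕ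
count P? xs = length (filter P? xs)

indicator : {P : Set} → Dec P → ℕ
indicator (yes _) = 1
indicator (no _)  = 0

module _ {X : Set} {P : X → Set} (P? : Decidable P) where

  count-∷ : (x : X) (xs : List X) → count P? (x ∷ xs) ≡ indicator (P? x) + count P? xs
  count-∷ x xs with P? x
  ... | yes _ = refl
  ... | no _  = refl

  count≡∑indicator : (xs : List X) → count P? xs ≡ ∑ xs (indicator ∘ P?)
  count≡∑indicator []       = refl
  count≡∑indicator (x ∷ xs) = trans (count-∷ x xs) (cong (indicator (P? x) +_) (count≡∑indicator xs))

module _ {X Y : Set} {R : X → Y → Set} (R? : ∀ x y → Dec (R x y)) where

  double-counting : (xs : List X) (ys : List Y) →
                    ∑ ys (λ y → count (λ x → R? x y) xs) ≡ ∑ xs (λ x → count (R? x) ys)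
  double-counting xs []       = trans (sym (*-zeroʳ (length xs))) (sym (∑-const xs 0))
  double-counting xs (y ∷ ys) = begin
    count (λ x → R? x y) xs + ∑ ys (λ y → count (λ x → R? x y) xs)
      ≡⟨ cong₂ _+_ (count≡∑indicator (λ x → R? x y) xs) (double-counting xs ys) ⟩
    ∑ xs (λ x → indicator (R? x y)) + ∑ xs (λ x → count (R? x) ys)
      ≡⟨ ∑-+ xs (λ x → indicator (R? x y)) (λ x → count (R? x) ys) ⟨
    ∑ xs (λ x → indicator (R? x y) + count (R? x) ys)
      ≡⟨ ∑-cong xs (λ x → count-∷ (R? x) y ys) ⟨
    ∑ xs (λ x → count (R? x) (y ∷ ys)) ∎
    where open ≡-Reasoning

  double-counting-≤ : (xs : List X) (ys : List Y) {c : ℕ} →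
                      All (λ y → c ≤ count (λ x → R? x y) xs) ys →
                      length ys * c ≤ ∑ xs (λ x → count (R? x) ys)
  double-counting-≤ xs ys {c} h = begin
    length ys * c                          ≡⟨ ∑-const ys c ⟨
    ∑ ys (λ _ → c)                         ≤⟨ ∑-mono-≤ ys h ⟩
    ∑ ys (λ y → count (λ x → R? x y) xs)   ≡⟨ double-counting xs ys ⟩
    ∑ xs (λ x → count (R? x) ys)           ∎
    where open ≤-Reasoning

  covering-bound : (xs : List X) (ys : List Y) {b : ℕ} →
                   All (λ y → Any (λ x → R x y) xs) ys → All (λ x → count (R? x) ys ≤ b) xs →
                   length ys ≤ length xs * b
  covering-bound xs ys {b} covered bounded = begin
    length ys                     ≡⟨ *-identityʳ (length ys) ⟨
    length ys * 1                 ≤⟨ double-counting-≤ xs ys (All.map (λ {y} → filter-some (λ x → R? x y)) covered) ⟩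
    ∑ xs (λ x → count (R? x) ys)  ≤⟨ ∑-mono-≤ xs bounded ⟩
    ∑ xs (λ _ → b)                ≡⟨ ∑-const xs b ⟩
    length xs * b                 ∎
    where open ≤-Reasoning

module _ {A : Set} (_≟_ : DecidableEquality A) where

  unique⊆⇒length≤ : {xs : List A} (ys : List A) → Unique xs → (∀ {x} → x ∈ xs → x ∈ ys) →
                    length xs ≤ length ys
  unique⊆⇒length≤ {[]}     ys _          _    = z≤n
  unique⊆⇒length≤ {x ∷ xs} ys (x∉xs ∷ u) x∷xs⊆ys = begin-strict
    length xs                ≤⟨ unique⊆⇒length≤ (filter x≢? ys) u xs⊆ys-x ⟩
    length (filter x≢? ys)   <⟨ filter-notAll x≢? ys (Any.map (λ x≡y x≢y → x≢y x≡y) (x∷xs⊆ys (here refl))) ⟩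
    length ys                ∎
    where
    open ≤-Reasoning
    x≢? : Decidable (x ≢_)
    x≢? y = ¬? (x ≟ y)
    xs⊆ys-x : ∀ {y} → y ∈ xs → y ∈ filter x≢? ys
    xs⊆ys-x y∈xs = ∈-filter⁺ x≢? (x∷xs⊆ys (there y∈xs)) (All.lookup x∉xs y∈xs)

private variable
  n : ℕ

_≟ₛ_ : DecidableEquality (Subset n)
_≟ₛ_ = ≡-dec _≟ᵇ_

∣p─q∣+∣q∣≡∣p∣ : (p q : Subset n) → q ⊆ p → ∣ p ─ q ∣ + ∣ q ∣ ≡ ∣ p ∣
∣p─q∣+∣q∣≡∣p∣ []            []            q⊆p = refl
∣p─q∣+∣q∣≡∣p∣ (inside ∷ p)  (outside ∷ q) q⊆p = cong suc (∣p─q∣+∣q∣≡∣p∣ p q (drop-∷-⊆ q⊆p))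
∣p─q∣+∣q∣≡∣p∣ (outside ∷ p) (outside ∷ q) q⊆p = ∣p─q∣+∣q∣≡∣p∣ p q (drop-∷-⊆ q⊆p)
∣p─q∣+∣q∣≡∣p∣ (inside ∷ p)  (inside ∷ q)  q⊆p = trans (+-suc _ _) (cong suc (∣p─q∣+∣q∣≡∣p∣ p q (drop-∷-⊆ q⊆p)))
∣p─q∣+∣q∣≡∣p∣ (outside ∷ p) (inside ∷ q)  q⊆p with q⊆p Vec.here
... | ()

∣p─q∣≡∣p∣∸∣q∣ : (p q : Subset n) → q ⊆ p → ∣ p ─ q ∣ ≡ ∣ p ∣ ∸ ∣ q ∣
∣p─q∣≡∣p∣∸∣q∣ p q q⊆p = trans (sym (m+n∸n≡m ∣ p ─ q ∣ ∣ q ∣)) (cong (_∸ ∣ q ∣) (∣p─q∣+∣q∣≡∣p∣ p q q⊆p))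

∣p∪q∣≡∣p∣+∣q∣ : (p q : Subset n) → p ∩ q ≡ ⊥ → ∣ p ∪ q ∣ ≡ ∣ p ∣ + ∣ q ∣
∣p∪q∣≡∣p∣+∣q∣ []            []            _  = refl
∣p∪q∣≡∣p∣+∣q∣ (inside ∷ p)  (inside ∷ q)  ()
∣p∪q∣≡∣p∣+∣q∣ (inside ∷ p)  (outside ∷ q) eq = cong suc (∣p∪q∣≡∣p∣+∣q∣ p q (∷-injectiveʳ eq))
∣p∪q∣≡∣p∣+∣q∣ (outside ∷ p) (inside ∷ q)  eq = trans (cong suc (∣p∪q∣≡∣p∣+∣q∣ p q (∷-injectiveʳ eq))) (sym (+-suc _ _))
∣p∪q∣≡∣p∣+∣q∣ (outside ∷ p) (outside ∷ q) eq = ∣p∪q∣≡∣p∣+∣q∣ p q (∷-injectiveʳ eq)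

p∩⋃qs≡⊥ : (p : Subset n) (qs : List (Subset n)) → All (λ q → p ∩ q ≡ ⊥) qs → p ∩ ⋃ qs ≡ ⊥
p∩⋃qs≡⊥ p []       []         = ∩-zeroʳ p
p∩⋃qs≡⊥ p (q ∷ qs) (p∩q≡⊥ ∷ h) =
  trans (∩-distribˡ-∪ p q (⋃ qs)) (trans (cong₂ _∪_ p∩q≡⊥ (p∩⋃qs≡⊥ p qs h)) (∪-identityʳ ⊥))

∣⋃ps∣≡∑∣ps∣ : {n : ℕ} (ps : List (Subset n)) → AllPairs (λ p q → p ∩ q ≡ ⊥) ps → ∣ ⋃ ps ∣ ≡ ∑ ps ∣_∣
∣⋃ps∣≡∑∣ps∣ {n} []       []       = ∣⊥∣≡0 n
∣⋃ps∣≡∑∣ps∣ (p ∷ ps) (h ∷ hs) =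
  trans (∣p∪q∣≡∣p∣+∣q∣ p (⋃ ps) (p∩⋃qs≡⊥ p ps h)) (cong (∣ p ∣ +_) (∣⋃ps∣≡∑∣ps∣ ps hs))

p⊆q∧p∩r≡⊥⇒p⊆q─r : {p q r : Subset n} → p ⊆ q → p ∩ r ≡ ⊥ → p ⊆ q ─ r
p⊆q∧p∩r≡⊥⇒p⊆q─r p⊆q p∩r≡⊥ x∈p =
  x∈p∧x∉q⇒x∈p─q (p⊆q x∈p) (λ x∈r → ∉⊥ (subst (_ Subset.∈_) p∩r≡⊥ (x∈p∩q⁺ (x∈p , x∈r))))

kSubsets : Subset n → ℕ → List (Subset n)
kSubsets []            zero    = [] ∷ []
kSubsets []            (suc k) = []
kSubsets (outside ∷ s) k       = map (outside ∷_) (kSubsets s k)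
kSubsets (inside ∷ s)  zero    = map (outside ∷_) (kSubsets s zero)
kSubsets (inside ∷ s)  (suc k) = map (outside ∷_) (kSubsets s (suc k)) ++ map (inside ∷_) (kSubsets s k)

length-kSubsets : (s : Subset n) (k : ℕ) → length (kSubsets s k) ≡ ∣ s ∣ C k
length-kSubsets []            zero    = refl
length-kSubsets []            (suc k) = refl
length-kSubsets (outside ∷ s) k       = trans (length-map _ (kSubsets s k)) (length-kSubsets s k)
length-kSubsets (inside ∷ s)  zero    = trans (length-map _ (kSubsets s zero)) (length-kSubsets s zero)
length-kSubsets (inside ∷ s)  (suc k) = begin
  length (map (outside ∷_) (kSubsets s (suc k)) ++ map (inside ∷_) (kSubsets s k))
    ≡⟨ length-++ (map (outside ∷_) (kSubsets s (suc k))) ⟩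
  length (map (outside ∷_) (kSubsets s (suc k))) + length (map (inside ∷_) (kSubsets s k))
    ≡⟨ cong₂ _+_ (length-map _ (kSubsets s (suc k))) (length-map _ (kSubsets s k)) ⟩
  length (kSubsets s (suc k)) + length (kSubsets s k)
    ≡⟨ cong₂ _+_ (length-kSubsets s (suc k)) (length-kSubsets s k) ⟩
  ∣ s ∣ C suc k + ∣ s ∣ C k
    ≡⟨ +-comm (∣ s ∣ C suc k) (∣ s ∣ C k) ⟩
  ∣ s ∣ C k + ∣ s ∣ C suc k
    ≡⟨ nCk+nC[k+1]≡[n+1]C[k+1] ∣ s ∣ k ⟩
  suc ∣ s ∣ C suc k ∎
  where open ≡-Reasoning

∈-kSubsets : {p : Subset n} (s : Subset n) (k : ℕ) → ∣ p ∣ ≡ k → p ⊆ s → p ∈ kSubsets s k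
∈-kSubsets {p = []}          []            .0      refl _   = here refl
∈-kSubsets {p = outside ∷ p} (outside ∷ s) k       eq   p⊆s = ∈-map⁺ _ (∈-kSubsets s k eq (drop-∷-⊆ p⊆s))
∈-kSubsets {p = outside ∷ p} (inside ∷ s)  zero    eq   p⊆s = ∈-map⁺ _ (∈-kSubsets s zero eq (drop-∷-⊆ p⊆s))
∈-kSubsets {p = outside ∷ p} (inside ∷ s)  (suc k) eq   p⊆s =
  ∈-++⁺ˡ (∈-map⁺ _ (∈-kSubsets s (suc k) eq (drop-∷-⊆ p⊆s)))
∈-kSubsets {p = inside ∷ p}  (inside ∷ s)  (suc k) eq   p⊆s =
  ∈-++⁺ʳ _ (∈-map⁺ _ (∈-kSubsets s k (suc-injective eq) (drop-∷-⊆ p⊆s)))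
∈-kSubsets {p = inside ∷ p}  (inside ∷ s)  zero    ()   _
∈-kSubsets {p = inside ∷ p}  (outside ∷ s) k       eq   p⊆s with p⊆s Vec.here
... | ()

*≤⇒≤/ : (d : ℕ) .{{_ : NonZero d}} (m o : ℕ) → d * m ≤ o → m ≤ o / d
*≤⇒≤/ d m o d*m≤o = subst (_≤ o / d) (trans (cong (_/ d) (*-comm d m)) (m*n/n≡m m d)) (/-monoˡ-≤ d d*m≤o)

module _ {n : ℕ} where

  open import Data.List.Membership.DecPropositional (_≟ₛ_ {n}) using (_∈?_)

  classes-disjoint : {k j : ℕ} {P : List (Subset n)} {A B : Subset n} → IsSubpartition n k j P →
                     A ∈ P → B ∈ P → A ≢ B → A ∩ B ≡ ⊥
  classes-disjoint {A = A} {B} sp = go (IsSubpartition.disjoint sp)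
    where
    go : {P : List (Subset n)} → AllPairs (λ A B → A ∩ B ≡ ⊥) P → A ∈ P → B ∈ P → A ≢ B → A ∩ B ≡ ⊥
    go (_ ∷ _)   (here refl) (here refl) A≢B = ⊥-elim (A≢B refl)
    go (h ∷ _)   (here refl) (there B∈P) _   = All.lookup h B∈P
    go (h ∷ _)   (there A∈P) (here refl) _   = trans (∩-comm A B) (All.lookup h A∈P)
    go (_ ∷ hs)  (there A∈P) (there B∈P) A≢B = go hs A∈P B∈P A≢B

  remove : Subset n → List (Subset n) → List (Subset n)
  remove A = filter (λ B → ¬? (B ≟ₛ A))

  ∈-remove⁺ : {A B : Subset n} {P : List (Subset n)} → B ∈ P → B ≢ A → B ∈ remove A P
  ∈-remove⁺ {A} = ∈-filter⁺ (λ B → ¬? (B ≟ₛ A))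

  ∈-remove⁻ : {A B : Subset n} (P : List (Subset n)) → B ∈ remove A P → B ∈ P × B ≢ A
  ∈-remove⁻ {A} P = ∈-filter⁻ (λ B → ¬? (B ≟ₛ A)) {xs = P}

  length-remove : {A : Subset n} (P : List (Subset n)) → Unique P → A ∈ P → suc (length (remove A P)) ≡ length P
  length-remove {A} (B ∷ P) (B∉P ∷ u) A∈B∷P with B ≟ₛ A | A∈B∷P
  ... | yes refl | _           = cong (suc ∘ length) (filter-all (λ C → ¬? (C ≟ₛ A)) (All.map (λ A≢C → A≢C ∘ sym) B∉P))
  ... | no B≢A   | here A≡B    = ⊥-elim (B≢A (sym A≡B))
  ... | no B≢A   | there A∈P   = cong suc (length-remove P u A∈P)

  SameSet-remove⁻ : {A : Subset n} {P Q : List (Subset n)} → A ∈ P → A ∈ Q →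
                    SameSet (remove A P) (remove A Q) → SameSet P Q
  SameSet-remove⁻ {A} {P} {Q} A∈P A∈Q same B with B ≟ₛ A
  ... | yes refl = mk⇔ (λ _ → A∈Q) (λ _ → A∈P)
  ... | no B≢A   = mk⇔ (λ B∈P → proj₁ (∈-remove⁻ Q (Equivalence.to   (same B) (∈-remove⁺ B∈P B≢A))))
                       (λ B∈Q → proj₁ (∈-remove⁻ P (Equivalence.from (same B) (∈-remove⁺ B∈Q B≢A))))

  remove-subpartition : {k j : ℕ} {A : Subset n} {P : List (Subset n)} →
                        IsSubpartition n k (suc j) P → A ∈ P → IsSubpartition n k j (remove A P)
  remove-subpartition {A = A} {P} sp A∈P = record
    { unique   = Unique.filter⁺ (λ B → ¬? (B ≟ₛ A)) (IsSubpartition.unique sp)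
    ; size     = suc-injective (trans (length-remove P (IsSubpartition.unique sp) A∈P) (IsSubpartition.size sp))
    ; classes  = All.filter⁺ (λ B → ¬? (B ≟ₛ A)) (IsSubpartition.classes sp)
    ; disjoint = AllPairs.filter⁺ (λ B → ¬? (B ≟ₛ A)) (IsSubpartition.disjoint sp)
    }

  record IsFamilyIn (S : Subset n) (k j : ℕ) (G : List (List (Subset n))) : Set where
    field
      members  : All (IsSubpartition n k j) G
      within   : All (All (_⊆ S)) G
      distinct : AllPairs (λ P Q → ¬ SameSet P Q) G

  open IsFamilyIn

  IsFamily⇒IsFamilyIn⊤ : {k j : ℕ} {G : List (List (Subset n))} → IsFamily n k j G → IsFamilyIn ⊤ k j G
  IsFamily⇒IsFamilyIn⊤ fam = record
    { members  = IsFamily.members fam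
    ; within   = All.map (λ _ → All.tabulate (λ _ {_} _ → ∈⊤)) (IsFamily.members fam)
    ; distinct = IsFamily.distinct fam
    }

  filter-IsFamilyIn : {S : Subset n} {k j : ℕ} {G : List (List (Subset n))} {R : List (Subset n) → Set}
                      (R? : Decidable R) → IsFamilyIn S k j G → IsFamilyIn S k j (filter R? G)
  filter-IsFamilyIn R? fam = record
    { members  = All.filter⁺ R? (members fam)
    ; within   = All.filter⁺ R? (within fam)
    ; distinct = AllPairs.filter⁺ R? (distinct fam)
    }

  remove-IsFamilyIn : {S A : Subset n} {k j : ℕ} {G : List (List (Subset n))} →
                      IsFamilyIn S k (suc j) G → All (A ∈_) G → IsFamilyIn (S ─ A) k j (map (remove A) G)
  remove-IsFamilyIn {S} {A} fam A∈G = record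
    { members  = All.map⁺ (All.zipWith (λ (sp , A∈P) → remove-subpartition sp A∈P) (members fam , A∈G))
    ; within   = All.map⁺ (All.zipWith (λ ((sp , P⊆S) , A∈P) → remove-within sp P⊆S A∈P)
                                       (All.zip (members fam , within fam) , A∈G))
    ; distinct = remove-distinct A∈G (distinct fam)
    }
    where
    remove-within : {k j : ℕ} {P : List (Subset n)} → IsSubpartition n k j P → All (_⊆ S) P → A ∈ P →
                    All (_⊆ S ─ A) (remove A P)
    remove-within {P = P} sp P⊆S A∈P = All.tabulate λ B∈ →
      let B∈P , B≢A = ∈-remove⁻ P B∈ in
      p⊆q∧p∩r≡⊥⇒p⊆q─r (All.lookup P⊆S B∈P) (classes-disjoint sp B∈P A∈P B≢A)
    remove-distinct : {G : List (List (Subset n))} → All (A ∈_) G → AllPairs (λ P Q → ¬ SameSet P Q) G →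
                      AllPairs (λ P Q → ¬ SameSet P Q) (map (remove A) G)
    remove-distinct []            []            = []
    remove-distinct (A∈P ∷ A∈G) (P≉G ∷ G≉G) =
      All.map⁺ (All.zipWith (λ (A∈Q , P≉Q) → P≉Q ∘ SameSet-remove⁻ A∈P A∈Q) (A∈G , P≉G))
      ∷ remove-distinct A∈G G≉G

  ∣S─class∣≡∣S∣∸k : {S A : Subset n} {k j : ℕ} {P : List (Subset n)} →
                    IsSubpartition n k j P → All (_⊆ S) P → A ∈ P → ∣ S ─ A ∣ ≡ ∣ S ∣ ∸ k
  ∣S─class∣≡∣S∣∸k {S} {A} sp P⊆S A∈P =
    trans (∣p─q∣≡∣p∣∸∣q∣ S A (All.lookup P⊆S A∈P)) (cong (∣ S ∣ ∸_) (All.lookup (IsSubpartition.classes sp) A∈P))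

  subpartition₀≡[] : {k : ℕ} {P : List (Subset n)} → IsSubpartition n k 0 P → P ≡ []
  subpartition₀≡[] {P = []}    _  = refl
  subpartition₀≡[] {P = _ ∷ _} sp with IsSubpartition.size sp
  ... | ()

  j≤count-classes-in-kSubsets : {S : Subset n} {k j : ℕ} {P : List (Subset n)} →
                                IsSubpartition n k j P → All (_⊆ S) P →
                                j ≤ count (_∈? P) (kSubsets S k)
  j≤count-classes-in-kSubsets {S} {k} {P = P} sp P⊆S =
    subst (_≤ count (_∈? P) (kSubsets S k)) (IsSubpartition.size sp)
      (unique⊆⇒length≤ _≟ₛ_ _ (IsSubpartition.unique sp) λ A∈P →
        ∈-filter⁺ (_∈? P) (∈-kSubsets S k (All.lookup (IsSubpartition.classes sp) A∈P) (All.lookup P⊆S A∈P)) A∈P)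

  j!*length≤binomProd : {S : Subset n} {k : ℕ} (j : ℕ) {G : List (List (Subset n))} →
                        IsFamilyIn S k j G → j ! * length G ≤ binomProd ∣ S ∣ j k
  j!*length≤binomProd zero {[]}        _   = z≤n
  j!*length≤binomProd zero {_ ∷ []}    _   = s≤s z≤n
  j!*length≤binomProd zero {P ∷ Q ∷ _} fam with members fam | distinct fam
  ... | spP ∷ spQ ∷ _ | (P≉Q ∷ _) ∷ _ rewrite subpartition₀≡[] spP | subpartition₀≡[] spQ =
    ⊥-elim (P≉Q (λ _ → mk⇔ id id))
  j!*length≤binomProd {S} {k} (suc j) {G} fam = begin
    suc j ! * length G                         ≡⟨ *-comm (suc j ! ) (length G) ⟩
    length G * (suc j * j !)                   ≡⟨ cong (length G *_) (*-comm (suc j) (j !)) ⟩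
    length G * (j ! * suc j)                   ≡⟨ *-assoc (length G) (j !) (suc j) ⟨
    length G * j ! * suc j                     ≡⟨ cong (_* suc j) (*-comm (length G) (j !)) ⟩
    j ! * length G * suc j                     ≡⟨ *-assoc (j !) (length G) (suc j) ⟩
    j ! * (length G * suc j)                   ≤⟨ *-monoʳ-≤ (j !) (double-counting-≤ _∈?_ Ks G classes-counted) ⟩
    j ! * ∑ Ks (λ A → count (A ∈?_) G)         ≡⟨ *-∑ (j !) Ks _ ⟩
    ∑ Ks (λ A → j ! * count (A ∈?_) G)         ≤⟨ ∑-mono-≤ Ks (All.tabulate (λ {A} _ → through A)) ⟩
    ∑ Ks (λ _ → binomProd (∣ S ∣ ∸ k) j k)     ≡⟨ ∑-const Ks _ ⟩
    length Ks * binomProd (∣ S ∣ ∸ k) j k      ≡⟨ cong (_* binomProd (∣ S ∣ ∸ k) j k) (length-kSubsets S k) ⟩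
    binomProd ∣ S ∣ (suc j) k                  ∎
    where
    open ≤-Reasoning
    Ks : List (Subset n)
    Ks = kSubsets S k
    classes-counted : All (λ P → suc j ≤ count (_∈? P) Ks) G
    classes-counted = All.zipWith (λ (sp , P⊆S) → j≤count-classes-in-kSubsets sp P⊆S) (members fam , within fam)
    through : (A : Subset n) → j ! * count (A ∈?_) G ≤ binomProd (∣ S ∣ ∸ k) j k
    through A with filter (A ∈?_) G | filter-IsFamilyIn (A ∈?_) fam | All.tabulate (proj₂ ∘ ∈-filter⁻ (A ∈?_) {xs = G})
    ... | []        | _    | _   = subst (_≤ binomProd (∣ S ∣ ∸ k) j k) (sym (*-zeroʳ (j !))) z≤n
    ... | H@(P ∷ _) | famH | A∈H = begin
      j ! * length H                     ≡⟨ cong (j ! *_) (length-map (remove A) H) ⟨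
      j ! * length (map (remove A) H)    ≤⟨ j!*length≤binomProd j (remove-IsFamilyIn famH A∈H) ⟩
      binomProd ∣ S ─ A ∣ j k            ≡⟨ cong (λ s → binomProd s j k) size ⟩
      binomProd (∣ S ∣ ∸ k) j k          ∎
      where
      size : ∣ S ─ A ∣ ≡ ∣ S ∣ ∸ k
      size = ∣S─class∣≡∣S∣∸k (All.head (members famH)) (All.head (within famH)) (All.head A∈H)

  length≤U : {S : Subset n} {k j : ℕ} {G : List (List (Subset n))} → IsFamilyIn S k j G → length G ≤ U ∣ S ∣ j k
  length≤U {j = j} {G} fam = *≤⇒≤/ (j !) {{j !≢0}} (length G) _ (j!*length≤binomProd j fam)

  extra-class⇒k+ℓ*k≤n : {k ℓ : ℕ} {A : Subset n} {Q : List (Subset n)} → IsSubpartition n k ℓ Q →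
                        ∣ A ∣ ≡ k → All (λ B → B ∩ A ≡ ⊥) Q → k + ℓ * k ≤ n
  extra-class⇒k+ℓ*k≤n {k} {ℓ} {A} {Q} sp ∣A∣≡k Q∩A≡⊥ = begin
    k + ℓ * k                 ≡⟨ cong₂ (λ a l → a + l * k) (sym ∣A∣≡k) (sym (IsSubpartition.size sp)) ⟩
    ∣ A ∣ + length Q * k      ≡⟨ cong (∣ A ∣ +_) (∑-const Q k) ⟨
    ∣ A ∣ + ∑ Q (λ _ → k)     ≤⟨ +-monoʳ-≤ ∣ A ∣ (∑-mono-≤ Q (All.map (≤-reflexive ∘ sym) (IsSubpartition.classes sp))) ⟩
    ∣ A ∣ + ∑ Q ∣_∣           ≡⟨ ∣⋃ps∣≡∑∣ps∣ (A ∷ Q) (A∩Q≡⊥ ∷ IsSubpartition.disjoint sp) ⟨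
    ∣ ⋃ (A ∷ Q) ∣             ≤⟨ ∣p∣≤n (⋃ (A ∷ Q)) ⟩
    n                         ∎
    where
    open ≤-Reasoning
    A∩Q≡⊥ : All (λ B → A ∩ B ≡ ⊥) Q
    A∩Q≡⊥ = All.map (λ {B} → trans (∩-comm A B)) Q∩A≡⊥

  BothIn : Subset n × Subset n → List (Subset n) → Set
  BothIn (A , B) R = A ∈ R × B ∈ R

  bothIn? : (p : Subset n × Subset n) (R : List (Subset n)) → Dec (BothIn p R)
  bothIn? (A , B) R = A ∈? R ×-dec B ∈? R

  length≤U-containing-pair : {S A B : Subset n} {k j : ℕ} {H : List (List (Subset n))} → B ≢ A →
                             IsFamilyIn S k (2 + j) H → All (BothIn (A , B)) H → length H ≤ U (∣ S ∣ ∸ 2 * k) j k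
  length≤U-containing-pair {H = []} _ _ _ = z≤n
  length≤U-containing-pair {S} {A} {B} {k} {j} {H@(_ ∷ _)} B≢A fam AB∈H = begin
    length H                                    ≡⟨ length-map (remove A) H ⟨
    length (map (remove A) H)                   ≡⟨ length-map (remove B) (map (remove A) H) ⟨
    length (map (remove B) (map (remove A) H))  ≤⟨ length≤U fam₂ ⟩
    U ∣ S ─ A ─ B ∣ j k                         ≡⟨ cong (λ m → U m j k) size ⟩
    U (∣ S ∣ ∸ 2 * k) j k                       ∎
    where
    open ≤-Reasoning
    fam₁ : IsFamilyIn (S ─ A) k (suc j) (map (remove A) H)
    fam₁ = remove-IsFamilyIn fam (All.map proj₁ AB∈H)
    B∈G₁ : All (B ∈_) (map (remove A) H)
    B∈G₁ = All.map⁺ (All.map (λ (_ , B∈R) → ∈-remove⁺ B∈R B≢A) AB∈H)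
    fam₂ : IsFamilyIn (S ─ A ─ B) k j (map (remove B) (map (remove A) H))
    fam₂ = remove-IsFamilyIn fam₁ B∈G₁
    size : ∣ S ─ A ─ B ∣ ≡ ∣ S ∣ ∸ 2 * k
    size = begin-equality
      ∣ S ─ A ─ B ∣     ≡⟨ ∣S─class∣≡∣S∣∸k (All.head (members fam₁)) (All.head (within fam₁)) (All.head B∈G₁) ⟩
      ∣ S ─ A ∣ ∸ k     ≡⟨ cong (_∸ k) (∣S─class∣≡∣S∣∸k (All.head (members fam)) (All.head (within fam))
                                                          (proj₁ (All.head AB∈H))) ⟩
      ∣ S ∣ ∸ k ∸ k     ≡⟨ ∸-+-assoc ∣ S ∣ k k ⟩
      ∣ S ∣ ∸ (k + k)   ≡⟨ cong (λ m → ∣ S ∣ ∸ (k + m)) (+-identityʳ k) ⟨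
      ∣ S ∣ ∸ 2 * k     ∎

  count-BothIn≤U : {k j : ℕ} {F : List (List (Subset n))} {A B : Subset n} → IsFamily n k (2 + j) F → B ≢ A →
                   count (bothIn? (A , B)) F ≤ U (n ∸ 2 * k) j k
  count-BothIn≤U {k} {j} {F} {A} {B} fam B≢A =
    subst (λ m → count (bothIn? (A , B)) F ≤ U (m ∸ 2 * k) j k) (∣⊤∣≡n n)
      (length≤U-containing-pair B≢A (filter-IsFamilyIn (bothIn? (A , B)) (IsFamily⇒IsFamilyIn⊤ fam))
                      (All.tabulate (proj₂ ∘ ∈-filter⁻ (bothIn? (A , B)) {xs = F})))

module _ {n k ℓ : ℕ} {F : List (List (Subset n))} (fam : IsFamily n k ℓ F) where

  open import Data.List.Membership.DecPropositional (_≟ₛ_ {n}) using (_∈?_)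

  Escape : Subset n → Set
  Escape A = ∃ λ Q → Q ∈ F × A ∉ Q

  escape : ¬ HasCommonClass k F → {A : Subset n} → ∣ A ∣ ≡ k → Escape A
  escape noCommon {A} ∣A∣≡k =
    find (All.¬All⇒Any¬ (A ∈?_) F λ A∈F → noCommon (A , ∣A∣≡k , λ _ → All.lookup A∈F))

  partners : Subset n → List (Subset n) → List (Subset n)
  partners A = filter (λ B → (B ∩ A) ≟ₛ ⊥)

  length-partners : n < k + ℓ * k → {A : Subset n} {Q : List (Subset n)} → ∣ A ∣ ≡ k → Q ∈ F →
                    length (partners A Q) ≤ ℓ ∸ 1
  length-partners n<k+ℓk {A} {Q} ∣A∣≡k Q∈F =
    ∸-monoˡ-≤ 1 (subst (length (partners A Q) <_) (IsSubpartition.size spQ)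
      (filter-notAll (λ B → (B ∩ A) ≟ₛ ⊥) Q
        (All.¬All⇒Any¬ (λ B → (B ∩ A) ≟ₛ ⊥) Q (<⇒≱ n<k+ℓk ∘ extra-class⇒k+ℓ*k≤n spQ ∣A∣≡k))))
    where
    spQ : IsSubpartition n k ℓ Q
    spQ = All.lookup (IsFamily.members fam) Q∈F

  partnerPairs : {P : List (Subset n)} → All Escape P → List (Subset n × Subset n)
  partnerPairs []                          = []
  partnerPairs {P = A ∷ _} ((Q , _) ∷ es) = map (A ,_) (partners A Q) ++ partnerPairs es

  length-partnerPairs : n < k + ℓ * k → {P : List (Subset n)} → All (λ A → ∣ A ∣ ≡ k) P →
                        (es : All Escape P) → length (partnerPairs es) ≤ length P * (ℓ ∸ 1)
  length-partnerPairs n<k+ℓk []              []                     = z≤n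
  length-partnerPairs n<k+ℓk {A ∷ P} (∣A∣≡k ∷ sizes) ((Q , Q∈F , _) ∷ es) = begin
    length (map (A ,_) (partners A Q) ++ partnerPairs es)            ≡⟨ length-++ (map (A ,_) (partners A Q)) ⟩
    length (map (A ,_) (partners A Q)) + length (partnerPairs es)    ≡⟨ cong (_+ _) (length-map (A ,_) (partners A Q)) ⟩
    length (partners A Q) + length (partnerPairs es)                 ≤⟨ +-mono-≤ (length-partners n<k+ℓk ∣A∣≡k Q∈F)
                                                                                  (length-partnerPairs n<k+ℓk sizes es) ⟩
    (ℓ ∸ 1) + length P * (ℓ ∸ 1)                                     ∎
    where open ≤-Reasoning

  partnerPairs-apart : {P : List (Subset n)} (es : All Escape P) →
                       All (λ p → proj₂ p ≢ proj₁ p) (partnerPairs es)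
  partnerPairs-apart []                       = []
  partnerPairs-apart {A ∷ _} ((Q , _ , A∉Q) ∷ es) =
    All.++⁺ (All.map⁺ (All.tabulate λ B∈ B≡A → A∉Q (subst (_∈ Q) B≡A (proj₁ (∈-filter⁻ (λ B → (B ∩ A) ≟ₛ ⊥) B∈)))))
            (partnerPairs-apart es)

  partnerPairs-cover : Intersecting F → {P : List (Subset n)} → P ∈ F → (es : All Escape P) →
                       All (λ R → Any (λ p → BothIn p R) (partnerPairs es)) F
  partnerPairs-cover inter P∈F es = All.tabulate λ {R} R∈F →
    let A , A∈R , A∈P = inter R _ R∈F P∈F in cover R∈F es (lose A∈P A∈R)
    where
    cover : {R : List (Subset n)} → R ∈ F → {P : List (Subset n)} (es : All Escape P) →
            Any (_∈ R) P → Any (λ p → BothIn p R) (partnerPairs es)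
    cover {R} R∈F {A ∷ _} ((Q , Q∈F , A∉Q) ∷ _) (here A∈R) with inter R Q R∈F Q∈F
    ... | B , B∈R , B∈Q = Any.++⁺ˡ (Any.map⁺ (lose (∈-filter⁺ (λ B → (B ∩ A) ≟ₛ ⊥) B∈Q B∩A≡⊥) (A∈R , B∈R)))
      where
      B≢A : B ≢ A
      B≢A refl = A∉Q B∈Q
      B∩A≡⊥ : B ∩ A ≡ ⊥
      B∩A≡⊥ = classes-disjoint (All.lookup (IsFamily.members fam) R∈F) B∈R A∈R B≢A
    cover R∈F (_ ∷ es) (there A∈R) = Any.++⁺ʳ _ (cover R∈F es A∈R)

n<k+ℓ*k : {n k ℓ : ℕ} → 1 ≤ k → n ≤ k * (ℓ + 1) ∸ 1 → n < k + ℓ * k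
n<k+ℓ*k {n} {suc k} {ℓ} _ n≤k[ℓ+1]∸1 = s≤s (subst (λ m → n ≤ m ∸ 1) k[ℓ+1]≡k+ℓk n≤k[ℓ+1]∸1)
  where
  open ≡-Reasoning
  k[ℓ+1]≡k+ℓk : suc k * (ℓ + 1) ≡ suc k + ℓ * suc k
  k[ℓ+1]≡k+ℓk = begin
    suc k * (ℓ + 1)      ≡⟨ cong (suc k *_) (+-comm ℓ 1) ⟩
    suc k * suc ℓ        ≡⟨ *-suc (suc k) ℓ ⟩
    suc k + suc k * ℓ    ≡⟨ cong (suc k +_) (*-comm (suc k) ℓ) ⟩
    suc k + ℓ * suc k    ∎

lemma2 : (n k ℓ : ℕ) → 1 ≤ n → 1 ≤ k → 2 ≤ ℓ →
    k * ℓ + 1 ≤ n → n ≤ k * (ℓ + 1) ∸ 1 →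
    (F : List (List (Subset n))) → IsFamily n k ℓ F → Intersecting F →
    ¬ HasCommonClass k F →
    length F ≤ ℓ * (ℓ ∸ 1) * U (n ∸ 2 * k) (ℓ ∸ 2) k
lemma2 n k ℓ _ _   _             _ _          []          _   _     _        = z≤n
lemma2 n k ℓ _ k≥1 (s≤s (s≤s _)) _ n≤k[ℓ+1]∸1 F@(P₀ ∷ _) fam inter noCommon = begin
  length F                                       ≤⟨ covering-bound bothIn? pairs F
                                                      (partnerPairs-cover fam inter (here refl) escapes)
                                                      (All.map (count-BothIn≤U fam) (partnerPairs-apart fam escapes)) ⟩
  length pairs * U (n ∸ 2 * k) (ℓ ∸ 2) k         ≤⟨ *-monoˡ-≤ _ (length-partnerPairs fam (n<k+ℓ*k k≥1 n≤k[ℓ+1]∸1)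
                                                                                 classes escapes) ⟩
  length P₀ * (ℓ ∸ 1) * U (n ∸ 2 * k) (ℓ ∸ 2) k  ≡⟨ cong (λ l → l * (ℓ ∸ 1) * _) (IsSubpartition.size sp₀) ⟩
  ℓ * (ℓ ∸ 1) * U (n ∸ 2 * k) (ℓ ∸ 2) k          ∎
  where
  open ≤-Reasoning
  sp₀ : IsSubpartition n k ℓ P₀
  sp₀ = All.head (IsFamily.members fam)
  classes : All (λ A → ∣ A ∣ ≡ k) P₀
  classes = IsSubpartition.classes sp₀
  escapes : All (Escape fam) P₀
  escapes = All.map (escape fam noCommon) classes
  pairs : List (Subset n × Subset n)
  pairs = partnerPairs fam escapes
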